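{- Let $s$ be a positive integer. (1) Let $G$ be a graph and $r_1$ a non-negative integer. If $q_s(G)>r_1$, then for every integer $n\geq |V(G)|$, $$AR(n,G)>r_1\left(n-\frac{r_1+1}{2}\right)+s.$$ (2) Let $L$ be a graph, and let $t_2\geq 0$ and $r_2\geq -t_2$ be integers. If $q_{s-i}(L\cup t_2P_2)>t_2+r_2+i$ for every $0\leq i\leq s$, then for all integers $t\geq t_2$ and $n\geq 2t+|V(L)|$, $$AR(n,L\cup tP_2)>(t+r_2)\left(n-\frac{t+r_2+1}{2}\right)+s.$$
   Context: A subgraph of an edge-coloured graph is multicoloured if all its edges have distinct colours. For a graph $G$ and an integer $n\geq |V(G)|$, $AR(n,G)$ is the minimal integer $r$ such that every edge-colouring of $K_n$ using at least $r$ colours contains a multicoloured copy of $G$. For a graph $G=(V,E)$ and sets $A,B\subseteq V$, $E_G(A,B)$ is the set of edges $uv\in E$ with $u\in A$, $v\in B$. For a non-negative integer $j$, $q_j(G):=\min\{|R| : R\subseteq V,\ |E_G(V\setminus R,V\setminus R)|\leq j\}$, i.e. the minimal size of a vertex set incident with all but at most $j$ edges of $G$. $P_2$ is a single edge, $tP_2$ is a matching of size $t$, and $L\cup tP_2$ is the vertex-disjoint union of $L$ and $tP_2$. -}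

module Defs where

open import Data.Nat using (ℕ; zero; suc; _+_; _*_; _≤_; _<_; _<ᵇ_; _≡ᵇ_; _/_)
open import Data.Nat.Properties using (_≟_)
open import Data.Bool using (Bool; true; false; _∨_; _∧_; not; if_then_else_; T)
open import Data.Fin using (Fin; toℕ; splitAt)
open import Data.Sum using (inj₁; inj₂)
open import Data.Product using (_×_; _,_; Σ)
open import Data.List using (List; []; _∷_; [_]; concatMap; allFin; filterᵇ; length; map; foldr; deduplicate)
open import Data.Vec using (Vec; lookup) renaming ([] to []ᵥ; _∷_ to _∷ᵥ_)
open import Data.Nat using (_⊓_)
open import Relation.Binary.PropositionalEquality using (_≡_; _≢_)
open import Relation.Nullary using (¬_)
open import Function.Definitions using (Injective)

-- The edge set is
-- { {u,v} : u ≠ v, adj u v = true or adj v u = true }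
-- (symmetric closure; loops ignored), so every finite simple graph is representable.
record Graph : Set where
  field
    V   : ℕ
    adj : Fin V → Fin V → Bool
open Graph public

Adj : (G : Graph) → Fin (V G) → Fin (V G) → Bool
Adj G u v = adj G u v ∨ adj G v u

pairs : (k : ℕ) → List (Fin k × Fin k)
pairs k = concatMap (λ u → concatMap (λ v → if toℕ u <ᵇ toℕ v then [ (u , v) ] else []) (allFin k)) (allFin k)

VSet : ℕ → Set
VSet k = Vec Bool k

size : ∀ {k} → VSet k → ℕ
size []ᵥ = 0
size (true ∷ᵥ R) = suc (size R)
size (false ∷ᵥ R) = size R

allSubsets : (k : ℕ) → List (VSet k)
allSubsets zero = []ᵥ ∷ []
allSubsets (suc k) = map (true ∷ᵥ_) (allSubsets k) Data.List.++ map (false ∷ᵥ_) (allSubsets k)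

edgesOutside : (G : Graph) → VSet (V G) → ℕ
edgesOutside G R = length (filterᵇ (λ { (u , v) → Adj G u v ∧ not (lookup R u) ∧ not (lookup R v) }) (pairs (V G)))

-- q_j(G) = min { |R| : |E_G(V∖R,V∖R)| ≤ j }  (R = V always qualifies, so V G is a valid start value)
q : ℕ → Graph → ℕ
q j G = foldr _⊓_ (V G) (map size (filterᵇ (λ R → edgesOutside G R Data.Nat.≤ᵇ j) (allSubsets (V G))))

-- An edge-colouring of K_n: the edge {x,y} with x < y gets colour c x y
-- (entries c x y with x ≥ y are irrelevant).
Colouring : ℕ → Set
Colouring n = Fin n → Fin n → ℕ

colourOf : ∀ {n} → Colouring n → Fin n → Fin n → ℕ
colourOf c x y = if toℕ x <ᵇ toℕ y then c x y else c y x

numColours : (n : ℕ) → Colouring n → ℕ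
numColours n c = length (deduplicate _≟_ (map (λ { (x , y) → c x y }) (pairs n)))

HasMulticolouredCopy : (n : ℕ) → Colouring n → Graph → Set
HasMulticolouredCopy n c G =
  Σ (Fin (V G) → Fin n) λ f → Injective _≡_ _≡_ f ×
    (∀ u v u' v' → toℕ u < toℕ v → toℕ u' < toℕ v' →
       T (Adj G u v) → T (Adj G u' v') → (u , v) ≢ (u' , v') →
       colourOf c (f u) (f v) ≢ colourOf c (f u') (f v'))

ARProp : ℕ → Graph → ℕ → Set
ARProp n G r = (c : Colouring n) → r ≤ numColours n c → HasMulticolouredCopy n c G

IsAR : ℕ → Graph → ℕ → Set
IsAR n G a = ARProp n G a × (∀ b → b < a → ¬ ARProp n G b)

-- the matching t P_2 on vertex set Fin (2 * t): vertices 2i and 2i+1 adjacent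
matching : ℕ → Graph
matching t = record { V = 2 * t ; adj = λ u v → (toℕ u / 2) ≡ᵇ (toℕ v / 2) }

_∪G_ : Graph → Graph → Graph
L ∪G H = record { V = V L + V H ; adj = a }
  where
  a : Fin (V L + V H) → Fin (V L + V H) → Bool
  a x y with splitAt (V L) x | splitAt (V L) y
  ... | inj₁ x' | inj₁ y' = adj L x' y'
  ... | inj₂ x' | inj₂ y' = adj H x' y'
  ... | _ | _ = false

module Submission where

-- Colour K_n by giving the pairs that meet the first k vertices pairwise distinct colours and letting
-- all other pairs share s further colours; when q_s(G) > k there are at least s other pairs, so
-- s + k(n − (k+1)/2) colours are used.  A multicoloured copy of G would have at most s edges avoiding
-- the preimage of the first k vertices, a set of at most k vertices, contradicting q_s(G) > k.
-- For (2), take k = t + r₂ and restrict a cover of L ∪ tP₂ to L ∪ t₂P₂: each of the t − t₂ further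
-- matching edges either stays uncovered or costs the cover a vertex, so if i of them stay uncovered the
-- restriction has at most t₂ + i + r₂ vertices and misses at most s − i edges, contradicting
-- q_{s−i}(L ∪ t₂P₂) > t₂ + i + r₂.

open import Defs
open import Data.Nat using (ℕ; zero; suc; >-nonZero; _+_; _*_; _≤_; _<_; _∸_; _⊓_; _<ᵇ_; _/_; z≤n; s≤s; _<?_)
open import Data.Integer using (ℤ; +_; -_; +<+) renaming (_+_ to _+ℤ_; _*_ to _*ℤ_; _<_ to _<ℤ_; _≤_ to _≤ℤ_)
open import Data.Product using (_×_; _,_; Σ-syntax; proj₁; proj₂)

open import Data.Nat.Properties
import Data.Integer.Properties as ℤ
open import Data.Nat.DivMod using (m*n/n≡m; +-distrib-/; m*n%n≡0)
open import Data.Nat.Solver using (module +-*-Solver)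
open import Data.Bool using (Bool; true; false; _∨_; _∧_; not; if_then_else_; T)
open import Data.Bool.Properties using (T-≡; T-∨; T-∧; T-not-≡)
open import Data.Unit using (tt)
open import Data.Empty using (⊥; ⊥-elim)
import Data.Sum
open import Data.Sum using (_⊎_; inj₁; inj₂)
import Data.Fin as Fin
open import Data.Fin using (Fin; toℕ; fromℕ<; inject≤; splitAt; _↑ˡ_; _↑ʳ_) renaming (_≟_ to _≟ᶠ_)
open import Data.Fin.Properties
  using (toℕ-injective; toℕ<n; toℕ-fromℕ<; toℕ-inject≤; toℕ-↑ˡ; toℕ-↑ʳ)
open import Data.Fin.Properties using (splitAt-↑ˡ; splitAt-↑ʳ; splitAt⁻¹-↑ˡ; splitAt⁻¹-↑ʳ)
open import Data.Product.Properties using (≡-dec)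
open import Data.Vec using (lookup) renaming ([] to []ᵥ; _∷_ to _∷ᵥ_; tabulate to tabulateᵥ)
open import Data.Vec.Properties using (lookup∘tabulate)
open import Data.List using (List; []; _∷_; [_]; _++_; map; length; filterᵇ; concatMap; allFin; foldr; tabulate; deduplicate)
open import Data.List.Properties using (length-++; length-map; length-upTo; length-tabulate)
open import Data.List.Membership.Propositional using (_∈_; lose; find)
open import Data.List.Membership.Propositional.Properties
open import Data.List.Relation.Unary.Any using (here; there)
open import Data.List.Relation.Unary.All using (All; []; _∷_)
import Data.List.Relation.Unary.All as All
open import Data.List.Relation.Unary.AllPairs using ([]; _∷_)
open import Data.List.Relation.Unary.Unique.Propositional using (Unique)
import Data.List.Relation.Unary.Unique.Propositional.Properties as Unique
open import Relation.Binary.PropositionalEquality hiding ([_])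
open import Relation.Binary using (tri<; tri≈; tri>)
open import Relation.Nullary using (¬_; yes; no)
open import Relation.Nullary.Decidable using (T?)
open import Function using (_∘_; id)
open import Function.Bundles using (Equivalence)
open import Function.Definitions using (Injective)

private variable
  A B : Set

Unique-⊆⇒length≤ : {ys xs : List A} → Unique ys → (∀ {y} → y ∈ ys → y ∈ xs) → length ys ≤ length xs
Unique-⊆⇒length≤ {ys = []} _ _ = z≤n
Unique-⊆⇒length≤ {ys = y ∷ ys} (y∉ys ∷ u) ys⊆xs with ∈-∃++ (ys⊆xs (here refl))
... | as , bs , refl = begin
  suc (length ys)           ≤⟨ s≤s (Unique-⊆⇒length≤ u ys⊆as++bs) ⟩
  suc (length (as ++ bs))   ≡⟨ cong suc (length-++ as) ⟩
  suc (length as + length bs) ≡⟨ +-suc (length as) (length bs) ⟨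
  length as + suc (length bs) ≡⟨ length-++ as ⟨
  length (as ++ y ∷ bs)     ∎
  where
  open ≤-Reasoning
  ys⊆as++bs : ∀ {z} → z ∈ ys → z ∈ as ++ bs
  ys⊆as++bs {z} z∈ys with ∈-++⁻ as (ys⊆xs (there z∈ys))
  ... | inj₁ z∈as = ∈-++⁺ˡ z∈as
  ... | inj₂ (here refl) = ⊥-elim (All.lookup y∉ys z∈ys refl)
  ... | inj₂ (there z∈bs) = ∈-++⁺ʳ as z∈bs

Unique-map⁺-on : {xs : List A} (g : A → B) → Unique xs →
  (∀ {x y} → x ∈ xs → y ∈ xs → g x ≡ g y → x ≡ y) → Unique (map g xs)
Unique-map⁺-on {xs = []} g _ _ = []
Unique-map⁺-on {xs = x ∷ xs} g (x∉xs ∷ u) inj =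
  All-map (λ z∈xs → inj (here refl) (there z∈xs)) x∉xs ∷ Unique-map⁺-on g u (λ p q → inj (there p) (there q))
  where
  All-map : ∀ {zs} → (∀ {z} → z ∈ zs → g x ≡ g z → x ≡ z) → All (x ≢_) zs → All (g x ≢_) (map g zs)
  All-map {[]} _ [] = []
  All-map {z ∷ zs} inj-x (x≢z ∷ x≢zs) = (x≢z ∘ inj-x (here refl)) ∷ All-map (inj-x ∘ there) x≢zs

Unique-bounded⇒length≤ : (b : ℕ) {ys : List ℕ} → Unique ys → (∀ {y} → y ∈ ys → y < b) → length ys ≤ b
Unique-bounded⇒length≤ b u bounded =
  subst (_ ≤_) (length-upTo b) (Unique-⊆⇒length≤ u (∈-upTo⁺ ∘ bounded))

Unique-concatMap⁺ : {xs : List A} (g : A → List B) (key : B → A) →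
  (∀ x {y} → y ∈ g x → key y ≡ x) → (∀ x → Unique (g x)) → Unique xs → Unique (concatMap g xs)
Unique-concatMap⁺ {xs = []} _ _ _ _ _ = []
Unique-concatMap⁺ {xs = x ∷ xs} g key key-g u-g (x∉xs ∷ u) =
  Unique.++⁺ (u-g x) (Unique-concatMap⁺ g key key-g u-g u) disjoint
  where
  disjoint : ∀ {y} → y ∈ g x × y ∈ concatMap g xs → ⊥
  disjoint (y∈gx , y∈rest) with find (∈-concatMap⁻ g y∈rest)
  ... | x' , x'∈xs , y∈gx' = All.lookup x∉xs x'∈xs (trans (sym (key-g x y∈gx)) (key-g x' y∈gx'))

∈-filterᵇ⁻ : {p : A → Bool} {xs : List A} {x : A} → x ∈ filterᵇ p xs → x ∈ xs × T (p x)
∈-filterᵇ⁻ {p = p} = ∈-filter⁻ (T? ∘ p)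

∈-filterᵇ⁺ : {p : A → Bool} {xs : List A} {x : A} → x ∈ xs → T (p x) → x ∈ filterᵇ p xs
∈-filterᵇ⁺ {p = p} = ∈-filter⁺ (T? ∘ p)

Unique-filterᵇ⁺ : (p : A → Bool) {xs : List A} → Unique xs → Unique (filterᵇ p xs)
Unique-filterᵇ⁺ p = Unique.filter⁺ (T? ∘ p)

-- Edges of K_k and vertex sets

if-singleton⁺ : (b : Bool) {x : A} → T b → x ∈ (if b then [ x ] else [])
if-singleton⁺ true _ = here refl

if-singleton⁻ : (b : Bool) {x y : A} → y ∈ (if b then [ x ] else []) → T b × y ≡ x
if-singleton⁻ true (here refl) = tt , refl

Unique-if-singleton : (b : Bool) {x : A} → Unique (if b then [ x ] else [])
Unique-if-singleton true = [] ∷ []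
Unique-if-singleton false = []

∈-pairs⁺ : ∀ {k} {u v : Fin k} → toℕ u < toℕ v → (u , v) ∈ pairs k
∈-pairs⁺ {k} {u} {v} u<v =
  ∈-concatMap⁺ _ (lose (∈-allFin u)
    (∈-concatMap⁺ _ (lose (∈-allFin v) (if-singleton⁺ (toℕ u <ᵇ toℕ v) (<⇒<ᵇ u<v)))))

∈-pairs⁻ : ∀ {k} {u v : Fin k} → (u , v) ∈ pairs k → toℕ u < toℕ v
∈-pairs⁻ {k} uv∈ with find (∈-concatMap⁻ _ {xs = allFin k} uv∈)
... | u , _ , uv∈row with find (∈-concatMap⁻ _ {xs = allFin k} uv∈row)
... | v , _ , uv∈cell with if-singleton⁻ (toℕ u <ᵇ toℕ v) uv∈cell
... | u<ᵇv , refl = <ᵇ⇒< _ _ u<ᵇv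

Unique-pairs : ∀ k → Unique (pairs k)
Unique-pairs k =
  Unique-concatMap⁺ _ proj₁ row-key
    (λ u → Unique-concatMap⁺ _ proj₂ (cell-key u) (λ v → Unique-if-singleton (toℕ u <ᵇ toℕ v)) (Unique.allFin⁺ k))
    (Unique.allFin⁺ k)
  where
  cell-key : ∀ u v {e} → e ∈ (if toℕ u <ᵇ toℕ v then [ (u , v) ] else []) → proj₂ e ≡ v
  cell-key u v e∈ with if-singleton⁻ (toℕ u <ᵇ toℕ v) e∈
  ... | _ , refl = refl
  row-key : ∀ u {e} → e ∈ concatMap (λ v → if toℕ u <ᵇ toℕ v then [ (u , v) ] else []) (allFin k) → proj₁ e ≡ u
  row-key u e∈ with find (∈-concatMap⁻ _ {xs = allFin k} e∈)
  ... | v , _ , e∈cell with if-singleton⁻ (toℕ u <ᵇ toℕ v) e∈cell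
  ... | _ , refl = refl

length-filterᵇ-tabulate : ∀ {k} (R : VSet k) (g : Fin k → A) (p : A → Bool) →
  (∀ i → p (g i) ≡ lookup R i) → length (filterᵇ p (tabulate g)) ≡ size R
length-filterᵇ-tabulate []ᵥ g p agrees = refl
length-filterᵇ-tabulate (b ∷ᵥ R) g p agrees with p (g Fin.zero) | agrees Fin.zero
... | true | refl = cong suc (length-filterᵇ-tabulate R (g ∘ Fin.suc) p (agrees ∘ Fin.suc))
... | false | refl = length-filterᵇ-tabulate R (g ∘ Fin.suc) p (agrees ∘ Fin.suc)

members : ∀ {k} → VSet k → List (Fin k)
members {k} R = filterᵇ (lookup R) (allFin k)

size≡length-members : ∀ {k} (R : VSet k) → size R ≡ length (members R)
size≡length-members R = sym (length-filterᵇ-tabulate R id (lookup R) (λ _ → refl))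

≤size : ∀ {k} (R : VSet k) {xs : List (Fin k)} → Unique xs → (∀ {x} → x ∈ xs → T (lookup R x)) → length xs ≤ size R
≤size R u xs⊆R = subst (_ ≤_) (sym (size≡length-members R))
  (Unique-⊆⇒length≤ u (λ x∈ → ∈-filterᵇ⁺ {p = lookup R} (∈-allFin _) (xs⊆R x∈)))

size≤ : ∀ {k} (R : VSet k) (g : Fin k → ℕ) (b : ℕ) → Injective _≡_ _≡_ g →
  (∀ {x} → T (lookup R x) → g x < b) → size R ≤ b
size≤ R g b injective bounded = begin
  size R                  ≡⟨ size≡length-members R ⟩
  length (members R)      ≡⟨ length-map g (members R) ⟨
  length (map g (members R)) ≤⟨ Unique-bounded⇒length≤ b unique bounded-on ⟩
  b                       ∎
  where
  open ≤-Reasoning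
  unique : Unique (map g (members R))
  unique = Unique.map⁺ injective (Unique-filterᵇ⁺ (lookup R) (Unique.allFin⁺ _))
  bounded-on : ∀ {y} → y ∈ map g (members R) → y < b
  bounded-on y∈ with ∈-map⁻ g y∈
  ... | x , x∈ , refl = bounded (proj₂ (∈-filterᵇ⁻ {p = lookup R} {xs = allFin _} x∈))

preimage : ∀ {k n} → (Fin k → Fin n) → ℕ → VSet k
preimage f m = tabulateᵥ (λ u → toℕ (f u) <ᵇ m)

size-preimage≤ : ∀ {k n} (f : Fin k → Fin n) (m : ℕ) → Injective _≡_ _≡_ f → size (preimage f m) ≤ m
size-preimage≤ f m injective = size≤ (preimage f m) (toℕ ∘ f) m (injective ∘ toℕ-injective) in-preimage
  where
  in-preimage : ∀ {u} → T (lookup (preimage f m) u) → toℕ (f u) < m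
  in-preimage {u} u∈ = <ᵇ⇒< _ _ (subst T (lookup∘tabulate (λ u → toℕ (f u) <ᵇ m) u) u∈)

∉preimage : ∀ {k n} (f : Fin k → Fin n) (m : ℕ) {u} → lookup (preimage f m) u ≡ false → m ≤ toℕ (f u)
∉preimage f m {u} u∉ =
  ≮⇒≥ (λ fu<m → subst T (trans (sym (lookup∘tabulate (λ u → toℕ (f u) <ᵇ m) u)) u∉) (<⇒<ᵇ fu<m))

∈-allSubsets : ∀ {k} (R : VSet k) → R ∈ allSubsets k
∈-allSubsets []ᵥ = here refl
∈-allSubsets (true ∷ᵥ R) = ∈-++⁺ˡ (∈-map⁺ (true ∷ᵥ_) (∈-allSubsets R))
∈-allSubsets {suc k} (false ∷ᵥ R) = ∈-++⁺ʳ (map (true ∷ᵥ_) (allSubsets k)) (∈-map⁺ (false ∷ᵥ_) (∈-allSubsets R))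

foldr-⊓-≤ : ∀ d {x} (xs : List ℕ) → x ∈ xs → foldr _⊓_ d xs ≤ x
foldr-⊓-≤ d (y ∷ ys) (here refl) = m⊓n≤m y _
foldr-⊓-≤ d (y ∷ ys) (there x∈ys) = ≤-trans (m⊓n≤n y _) (foldr-⊓-≤ d ys x∈ys)

q≤size : ∀ j G (R : VSet (V G)) → edgesOutside G R ≤ j → q j G ≤ size R
q≤size j G R few = foldr-⊓-≤ (V G) _ (∈-map⁺ size (∈-filterᵇ⁺ (∈-allSubsets R) (≤⇒≤ᵇ few)))

T-not∧not⁻ : ∀ {b c} → T (not b ∧ not c) → b ≡ false × c ≡ false
T-not∧not⁻ b̅∧c̅ with Equivalence.to T-∧ b̅∧c̅
... | b̅ , c̅ = Equivalence.to T-not-≡ b̅ , Equivalence.to T-not-≡ c̅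

T-not∧not⁺ : ∀ {b c} → b ≡ false → c ≡ false → T (not b ∧ not c)
T-not∧not⁺ b≡false c≡false = Equivalence.from T-∧ (Equivalence.from T-not-≡ b≡false , Equivalence.from T-not-≡ c≡false)

record OutsideEdge (G : Graph) (R : VSet (V G)) (u v : Fin (V G)) : Set where
  field
    ordered  : toℕ u < toℕ v
    adjacent : T (Adj G u v)
    left∉    : lookup R u ≡ false
    right∉   : lookup R v ≡ false

isOutsideEdge : (G : Graph) → VSet (V G) → Fin (V G) × Fin (V G) → Bool
isOutsideEdge G R (u , v) = Adj G u v ∧ not (lookup R u) ∧ not (lookup R v)

outsideEdges : (G : Graph) → VSet (V G) → List (Fin (V G) × Fin (V G))
outsideEdges G R = filterᵇ (isOutsideEdge G R) (pairs (V G))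

module _ {G : Graph} {R : VSet (V G)} where

  ∈-outsideEdges⁻ : ∀ {u v} → (u , v) ∈ outsideEdges G R → OutsideEdge G R u v
  ∈-outsideEdges⁻ {u} {v} uv∈ with ∈-filterᵇ⁻ {p = isOutsideEdge G R} uv∈
  ... | uv∈pairs , outside with Equivalence.to T-∧ outside
  ... | adjacent , avoids-R = record
    { ordered  = ∈-pairs⁻ uv∈pairs
    ; adjacent = adjacent
    ; left∉    = proj₁ (T-not∧not⁻ avoids-R)
    ; right∉   = proj₂ (T-not∧not⁻ avoids-R)
    }

  ∈-outsideEdges⁺ : ∀ {u v} → OutsideEdge G R u v → (u , v) ∈ outsideEdges G R
  ∈-outsideEdges⁺ {u} {v} e =
    ∈-filterᵇ⁺ (∈-pairs⁺ ordered) (Equivalence.from T-∧ (adjacent , T-not∧not⁺ left∉ right∉))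
    where open OutsideEdge e

  Unique-outsideEdges : Unique (outsideEdges G R)
  Unique-outsideEdges = Unique-filterᵇ⁺ (isOutsideEdge G R) (Unique-pairs (V G))

  edgesOutside≤ : (g : Fin (V G) → Fin (V G) → ℕ) (b : ℕ) →
    (∀ {u v} → OutsideEdge G R u v → g u v < b) →
    (∀ {u v u' v'} → OutsideEdge G R u v → OutsideEdge G R u' v' → g u v ≡ g u' v' → (u , v) ≡ (u' , v')) →
    edgesOutside G R ≤ b
  edgesOutside≤ g b bounded injective =
    subst (_≤ b) (length-map g′ (outsideEdges G R))
      (Unique-bounded⇒length≤ b (Unique-map⁺-on g′ Unique-outsideEdges injective-on) bounded-on)
    where
    g′ : Fin (V G) × Fin (V G) → ℕ
    g′ (u , v) = g u v
    bounded-on : ∀ {y} → y ∈ map g′ (outsideEdges G R) → y < b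
    bounded-on y∈ with ∈-map⁻ g′ y∈
    ... | (u , v) , uv∈ , refl = bounded (∈-outsideEdges⁻ uv∈)
    injective-on : ∀ {e e'} → e ∈ outsideEdges G R → e' ∈ outsideEdges G R → g′ e ≡ g′ e' → e ≡ e'
    injective-on {u , v} {u' , v'} e∈ e'∈ = injective (∈-outsideEdges⁻ e∈) (∈-outsideEdges⁻ e'∈)

  ≤edgesOutside : {es : List (Fin (V G) × Fin (V G))} → Unique es →
    (∀ {u v} → (u , v) ∈ es → OutsideEdge G R u v) → length es ≤ edgesOutside G R
  ≤edgesOutside u outside = Unique-⊆⇒length≤ u (λ {(u , v)} uv∈ → ∈-outsideEdges⁺ (outside uv∈))

Uncoverable : ℕ → Graph → ℕ → Set
Uncoverable j G k = (R : VSet (V G)) → size R ≤ k → edgesOutside G R ≤ j → ⊥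

<q⇒Uncoverable : ∀ j G {k} → k < q j G → Uncoverable j G k
<q⇒Uncoverable j G k<q R small few = <⇒≱ k<q (≤-trans (q≤size j G R few) small)

-- The lexicographic order on the edges of K_n

-- offset n x counts the pairs x' < y < n with x' < x, so rank n x y is the position of the pair
-- (x, y) in the lexicographic enumeration of the edges of K_n.
offset : ℕ → ℕ → ℕ
offset n zero = 0
offset n (suc x) = offset n x + (n ∸ suc x)

rank : ℕ → ℕ → ℕ → ℕ
rank n x y = offset n x + (y ∸ suc x)

offset-mono-≤ : ∀ n {x x'} → x ≤ x' → offset n x ≤ offset n x'
offset-mono-≤ n {x} {x'} x≤x' = subst (λ z → offset n x ≤ offset n z) (m∸n+n≡m x≤x') (grow (x' ∸ x))
  where
  grow : ∀ d → offset n x ≤ offset n (d + x)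
  grow zero = ≤-refl
  grow (suc d) = ≤-trans (grow d) (m≤m+n _ _)

offset≤rank : ∀ n x y → offset n x ≤ rank n x y
offset≤rank n x y = m≤m+n _ _

≤⇒offset≤rank : ∀ n {k x} y → k ≤ x → offset n k ≤ rank n x y
≤⇒offset≤rank n y k≤x = ≤-trans (offset-mono-≤ n k≤x) (offset≤rank n _ y)

rank<offset : ∀ n {x y} → x < y → y < n → rank n x y < offset n (suc x)
rank<offset n {x} x<y y<n = +-monoʳ-< (offset n x) (∸-monoˡ-< y<n x<y)

rank-injective : ∀ n {x y x' y'} → x < y → y < n → x' < y' → y' < n → rank n x y ≡ rank n x' y' → x ≡ x' × y ≡ y'
rank-injective n {x} {y} {x'} {y'} x<y y<n x'<y' y'<n eq with <-cmp x x'
... | tri< x<x' _ _ = ⊥-elim (<-irrefl eq (<-≤-trans (rank<offset n x<y y<n) (≤⇒offset≤rank n y' x<x')))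
... | tri> _ _ x'<x = ⊥-elim (<-irrefl (sym eq) (<-≤-trans (rank<offset n x'<y' y'<n) (≤⇒offset≤rank n y x'<x)))
... | tri≈ _ refl _ = refl , ∸-cancelʳ-≡ x<y x'<y' (+-cancelˡ-≡ (offset n x) _ _ eq)

rank-surjective : ∀ n m → m ≤ n → ∀ r → r < offset n m → Σ[ x ∈ ℕ ] Σ[ y ∈ ℕ ] x < y × y < n × rank n x y ≡ r
rank-surjective n zero _ r ()
rank-surjective n (suc m) m<n r r<offset with r <? offset n m
... | yes r<offset′ = rank-surjective n m (<⇒≤ m<n) r r<offset′
... | no r≮offset = m , suc m + d , m<y , y<n , rank≡r
  where
  offset≤r : offset n m ≤ r
  offset≤r = ≮⇒≥ r≮offset
  d = r ∸ offset n m
  d<row : d < n ∸ suc m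
  d<row = +-cancelˡ-< (offset n m) _ _ (subst (_< offset n (suc m)) (sym (m+[n∸m]≡n offset≤r)) r<offset)
  m<y : m < suc m + d
  m<y = <-≤-trans (n<1+n m) (m≤m+n (suc m) d)
  y<n : suc m + d < n
  y<n = subst (suc m + d <_) (m+[n∸m]≡n m<n) (+-monoʳ-< (suc m) d<row)
  rank≡r : offset n m + (suc m + d ∸ suc m) ≡ r
  rank≡r = trans (cong (λ z → offset n m + z) (m+n∸m≡n (suc m) d)) (m+[n∸m]≡n offset≤r)

offset-formula : ∀ n k → k ≤ n → 2 * offset n k + k * (k + 1) ≡ 2 * k * n
offset-formula n zero _ = refl
offset-formula n (suc k) k<n = +-cancelʳ-≡ (k * (k + 1)) _ _ (begin
    2 * (o + d) + suc k * (suc k + 1) + k * (k + 1)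
  ≡⟨ solve 3 (λ o d k → con 2 :* (o :+ d) :+ (con 1 :+ k) :* ((con 1 :+ k) :+ con 1) :+ k :* (k :+ con 1)
              := (con 2 :* o :+ k :* (k :+ con 1)) :+ con 2 :* d :+ (con 1 :+ k) :* (k :+ con 2)) refl o d k ⟩
    (2 * o + k * (k + 1)) + 2 * d + suc k * (k + 2)
  ≡⟨ cong (λ z → z + 2 * d + suc k * (k + 2)) (offset-formula n k (<⇒≤ k<n)) ⟩
    2 * k * n + 2 * d + suc k * (k + 2)
  ≡⟨ cong (λ z → 2 * k * z + 2 * d + suc k * (k + 2)) n≡d+k+1 ⟩
    2 * k * (d + suc k) + 2 * d + suc k * (k + 2)
  ≡⟨ solve 2 (λ d k → con 2 :* k :* (d :+ (con 1 :+ k)) :+ con 2 :* d :+ (con 1 :+ k) :* (k :+ con 2)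
              := con 2 :* (con 1 :+ k) :* (d :+ (con 1 :+ k)) :+ k :* (k :+ con 1)) refl d k ⟩
    2 * suc k * (d + suc k) + k * (k + 1)
  ≡⟨ cong (λ z → 2 * suc k * z + k * (k + 1)) n≡d+k+1 ⟨
    2 * suc k * n + k * (k + 1) ∎)
  where
  open ≡-Reasoning
  open +-*-Solver
  o = offset n k
  d = n ∸ suc k
  n≡d+k+1 : n ≡ d + suc k
  n≡d+k+1 = sym (m∸n+n≡m k<n)

-- The colouring behind (1)

<ᵇ≡true : ∀ {m n} → m < n → (m <ᵇ n) ≡ true
<ᵇ≡true m<n = Equivalence.to T-≡ (<⇒<ᵇ m<n)

<ᵇ≡false : ∀ {m n} → ¬ m < n → (m <ᵇ n) ≡ false
<ᵇ≡false {m} {n} m≮n with m <ᵇ n in eq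
... | true = ⊥-elim (m≮n (<ᵇ⇒< m n (subst T (sym eq) tt)))
... | false = refl

-- Pairs meeting the first k vertices get the distinct colours s, s+1, …; all other pairs share
-- the colours 0, …, s−1, and use all of them as soon as there are at least s such pairs.
module PrefixColouring (n k s : ℕ) where

  colourOfRank : ℕ → ℕ
  colourOfRank r = if r <ᵇ offset n k then s + r else (r ∸ offset n k) ⊓ (s ∸ 1)

  colouring : Colouring n
  colouring x y = colourOfRank (rank n (toℕ x) (toℕ y))

  colourOfRank<s : 1 ≤ s → ∀ {r} → offset n k ≤ r → colourOfRank r < s
  colourOfRank<s 1≤s {r} offset≤r rewrite <ᵇ≡false (≤⇒≯ offset≤r) = ≤pred⇒< (m⊓n≤n _ (s ∸ 1))
    where
    ≤pred⇒< : ∀ {c} → c ≤ s ∸ 1 → c < s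
    ≤pred⇒< c≤ = <-≤-trans (s≤s c≤) (≤-reflexive (suc-pred s {{>-nonZero 1≤s}}))

  colourOfRank-attained : ∀ {c} r → r < offset n n → colourOfRank r ≡ c →
    Σ[ x ∈ ℕ ] Σ[ y ∈ ℕ ] x < y × y < n × colourOfRank (rank n x y) ≡ c
  colourOfRank-attained r r<total colour≡c with rank-surjective n n ≤-refl r r<total
  ... | x , y , x<y , y<n , refl = x , y , x<y , y<n , colour≡c

  colour-surjective : offset n k + s ≤ offset n n → ∀ j → j < s + offset n k →
    Σ[ x ∈ ℕ ] Σ[ y ∈ ℕ ] x < y × y < n × colourOfRank (rank n x y) ≡ j
  colour-surjective enough j j<total with j <? s
  ... | yes j<s = colourOfRank-attained (offset n k + j) (<-≤-trans (+-monoʳ-< (offset n k) j<s) enough) shared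
    where
    shared : colourOfRank (offset n k + j) ≡ j
    shared rewrite <ᵇ≡false (≤⇒≯ (m≤m+n (offset n k) j)) | m+n∸m≡n (offset n k) j = m≤n⇒m⊓n≡m (<⇒≤pred j<s)
  ... | no j≮s = colourOfRank-attained (j ∸ s) (<-≤-trans j∸s<offset (≤-trans (m≤m+n (offset n k) s) enough)) distinct
    where
    s≤j = ≮⇒≥ j≮s
    j∸s<offset : j ∸ s < offset n k
    j∸s<offset = +-cancelˡ-< s _ _ (subst (_< s + offset n k) (sym (m+[n∸m]≡n s≤j)) j<total)
    distinct : colourOfRank (j ∸ s) ≡ j
    distinct rewrite <ᵇ≡true j∸s<offset = m+[n∸m]≡n s≤j

  pairColour : Fin n × Fin n → ℕ
  pairColour (x , y) = colouring x y

  numColours≥ : offset n k + s ≤ offset n n → s + offset n k ≤ numColours n colouring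
  numColours≥ enough = subst (_≤ length (deduplicate _≟_ (map pairColour (pairs n)))) (length-upTo (s + offset n k))
    (Unique-⊆⇒length≤ (Unique.upTo⁺ (s + offset n k)) (λ j∈ → ∈-deduplicate⁺ _≟_ (used (∈-upTo⁻ j∈))))
    where
    used : ∀ {j} → j < s + offset n k → j ∈ map pairColour (pairs n)
    used {j} j< with colour-surjective enough j j<
    ... | x , y , x<y , y<n , colour≡j =
      subst (_∈ _) colour≡j′ (∈-map⁺ pairColour (∈-pairs⁺ {n} {fromℕ< (<-trans x<y y<n)} {fromℕ< y<n} ordered))
      where
      ordered : toℕ (fromℕ< (<-trans x<y y<n)) < toℕ (fromℕ< y<n)
      ordered rewrite toℕ-fromℕ< (<-trans x<y y<n) | toℕ-fromℕ< y<n = x<y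
      colour≡j′ : colouring (fromℕ< (<-trans x<y y<n)) (fromℕ< y<n) ≡ j
      colour≡j′ rewrite toℕ-fromℕ< (<-trans x<y y<n) | toℕ-fromℕ< y<n = colour≡j

module _ (G : Graph) {n : ℕ} (V≤n : V G ≤ n) where

  embed : Fin (V G) → Fin n
  embed u = inject≤ u V≤n

  embed-injective : Injective _≡_ _≡_ embed
  embed-injective {u} {v} eq =
    toℕ-injective (trans (sym (toℕ-inject≤ u V≤n)) (trans (cong toℕ eq) (toℕ-inject≤ v V≤n)))

  -- Outside the first k vertices of K_n, an edge uv of G is sent to a pair of rank in [offset n k, offset n n).
  edgesOutside-prefix≤ : ∀ k → edgesOutside G (preimage embed k) ≤ offset n n ∸ offset n k
  edgesOutside-prefix≤ k = edgesOutside≤ shifted-rank (offset n n ∸ offset n k) bounded injective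
    where
    open OutsideEdge
    shifted-rank : Fin (V G) → Fin (V G) → ℕ
    shifted-rank u v = rank n (toℕ u) (toℕ v) ∸ offset n k
    <n : ∀ (v : Fin (V G)) → toℕ v < n
    <n v = <-≤-trans (toℕ<n v) V≤n
    offset≤ : ∀ {u v} → OutsideEdge G (preimage embed k) u v → offset n k ≤ rank n (toℕ u) (toℕ v)
    offset≤ {u} {v} e = ≤⇒offset≤rank n (toℕ v) (subst (k ≤_) (toℕ-inject≤ u V≤n) (∉preimage embed k (left∉ e)))
    bounded : ∀ {u v} → OutsideEdge G (preimage embed k) u v → shifted-rank u v < offset n n ∸ offset n k
    bounded {u} {v} e = ∸-monoˡ-< rank<total (offset≤ e)
      where
      rank<total : rank n (toℕ u) (toℕ v) < offset n n
      rank<total = <-≤-trans (rank<offset n (ordered e) (<n v)) (offset-mono-≤ n (<-≤-trans (ordered e) (<⇒≤ (<n v))))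
    injective : ∀ {u v u' v'} → OutsideEdge G (preimage embed k) u v → OutsideEdge G (preimage embed k) u' v' →
      shifted-rank u v ≡ shifted-rank u' v' → (u , v) ≡ (u' , v')
    injective {u} {v} {u'} {v'} e e' eq
      with rank-injective n (ordered e) (<n v) (ordered e') (<n v') (∸-cancelʳ-≡ (offset≤ e) (offset≤ e') eq)
    ... | u≡u' , v≡v' = cong₂ _,_ (toℕ-injective u≡u') (toℕ-injective v≡v')

  Uncoverable⇒offset+s<offset : ∀ {s k} → Uncoverable s G k → offset n k + s < offset n n
  Uncoverable⇒offset+s<offset {s} {k} uncoverable = begin-strict
    offset n k + s                            <⟨ +-monoʳ-< (offset n k) s<outside ⟩
    offset n k + (offset n n ∸ offset n k)    ≡⟨ m+[n∸m]≡n offset≤ ⟩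
    offset n n                                ∎
    where
    open ≤-Reasoning
    s<outside : s < offset n n ∸ offset n k
    s<outside = <-≤-trans (≰⇒> (uncoverable (preimage embed k) (size-preimage≤ embed k embed-injective)))
                          (edgesOutside-prefix≤ k)
    offset≤ : offset n k ≤ offset n n
    offset≤ = <⇒≤ (m∸n≢0⇒n<m λ empty → <⇒≱ s<outside (subst (_≤ s) (sym empty) z≤n))

colourOf-< : ∀ {n} (c : Colouring n) {x y : Fin n} → toℕ x < toℕ y → colourOf c x y ≡ c x y
colourOf-< c x<y rewrite <ᵇ≡true x<y = refl

colourOf-> : ∀ {n} (c : Colouring n) {x y : Fin n} → toℕ y < toℕ x → colourOf c x y ≡ c y x
colourOf-> c y<x rewrite <ᵇ≡false (<⇒≯ y<x) = refl

module _ {n k s : ℕ} (1≤s : 1 ≤ s) (G : Graph) where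

  open PrefixColouring n k s

  -- The copy's edges avoiding the first k vertices of K_n carry distinct colours below s.
  multicoloured⇒edgesOutside≤ : ((f , _ , _) : HasMulticolouredCopy n colouring G) → edgesOutside G (preimage f k) ≤ s
  multicoloured⇒edgesOutside≤ (f , f-injective , distinct) = edgesOutside≤ copyColour s bounded injective
    where
    open OutsideEdge
    copyColour : Fin (V G) → Fin (V G) → ℕ
    copyColour u v = colourOf colouring (f u) (f v)
    below-s : ∀ {x} y → k ≤ toℕ x → colouring x y < s
    below-s y k≤x = colourOfRank<s 1≤s (≤⇒offset≤rank n (toℕ y) k≤x)
    bounded : ∀ {u v} → OutsideEdge G (preimage f k) u v → copyColour u v < s
    bounded {u} {v} e with <-cmp (toℕ (f u)) (toℕ (f v))
    ... | tri< fu<fv _ _ = subst (_< s) (sym (colourOf-< colouring fu<fv)) (below-s (f v) (∉preimage f k (left∉ e)))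
    ... | tri≈ _ fu≡fv _ = ⊥-elim (<-irrefl (cong toℕ (f-injective (toℕ-injective fu≡fv))) (ordered e))
    ... | tri> _ _ fv<fu = subst (_< s) (sym (colourOf-> colouring fv<fu)) (below-s (f u) (∉preimage f k (right∉ e)))
    injective : ∀ {u v u' v'} → OutsideEdge G (preimage f k) u v → OutsideEdge G (preimage f k) u' v' →
      copyColour u v ≡ copyColour u' v' → (u , v) ≡ (u' , v')
    injective {u} {v} {u'} {v'} e e' same with ≡-dec _≟ᶠ_ _≟ᶠ_ (u , v) (u' , v')
    ... | yes uv≡u'v' = uv≡u'v'
    ... | no uv≢u'v' = ⊥-elim (distinct u v u' v' (ordered e) (ordered e') (adjacent e) (adjacent e') uv≢u'v' same)

  s+offset<AR : V G ≤ n → Uncoverable s G k → ∀ {a} → ARProp n G a → s + offset n k < a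
  s+offset<AR V≤n uncoverable {a} ar = ≰⇒> λ a≤ → no-copy (ar colouring (≤-trans a≤ (numColours≥ enough)))
    where
    enough : offset n k + s ≤ offset n n
    enough = <⇒≤ (Uncoverable⇒offset+s<offset G V≤n uncoverable)
    no-copy : ¬ HasMulticolouredCopy n colouring G
    no-copy copy@(f , f-injective , _) =
      uncoverable (preimage f k) (size-preimage≤ f k f-injective) (multicoloured⇒edgesOutside≤ copy)

offset<offset⇒< : ∀ n {k m} → offset n k < offset n m → k < m
offset<offset⇒< n lt = ≰⇒> λ m≤k → <⇒≱ lt (offset-mono-≤ n m≤k)

AR-bound : ∀ {s} G {k n} → 1 ≤ s → V G ≤ n → Uncoverable s G k → ∀ {a} → ARProp n G a →
  2 * k * n + 2 * s < 2 * a + k * (k + 1)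
AR-bound {s} G {k} {n} 1≤s V≤n uncoverable {a} ar = begin-strict
  2 * k * n + 2 * s                         ≡⟨ cong (_+ 2 * s) (offset-formula n k k≤n) ⟨
  2 * offset n k + k * (k + 1) + 2 * s      ≡⟨ solve 3 (λ o k s → con 2 :* o :+ k :* (k :+ con 1) :+ con 2 :* s
                                                    := con 2 :* (s :+ o) :+ k :* (k :+ con 1)) refl (offset n k) k s ⟩
  2 * (s + offset n k) + k * (k + 1)        <⟨ +-monoˡ-< (k * (k + 1)) (*-monoʳ-< 2 (s+offset<AR 1≤s G V≤n uncoverable ar)) ⟩
  2 * a + k * (k + 1)                       ∎
  where
  open ≤-Reasoning
  open +-*-Solver
  k≤n : k ≤ n
  k≤n = <⇒≤ (offset<offset⇒< n (≤-<-trans (m≤m+n (offset n k) s) (Uncoverable⇒offset+s<offset G V≤n uncoverable)))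

-- Adding matching edges

sumAdj : (L M : Graph) → Fin (V L) ⊎ Fin (V M) → Fin (V L) ⊎ Fin (V M) → Bool
sumAdj L M (inj₁ x) (inj₁ y) = adj L x y
sumAdj L M (inj₂ x) (inj₂ y) = adj M x y
sumAdj L M (inj₁ _) (inj₂ _) = false
sumAdj L M (inj₂ _) (inj₁ _) = false

adj-∪G : (L M : Graph) (x y : Fin (V L + V M)) → adj (L ∪G M) x y ≡ sumAdj L M (splitAt (V L) x) (splitAt (V L) y)
adj-∪G L M x y with splitAt (V L) x | splitAt (V L) y
... | inj₁ _ | inj₁ _ = refl
... | inj₂ _ | inj₂ _ = refl
... | inj₁ _ | inj₂ _ = refl
... | inj₂ _ | inj₁ _ = refl

splitAt-inject≤ : ∀ m {n n'} (le : m + n ≤ m + n') (le′ : n ≤ n') (u : Fin (m + n)) →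
  splitAt m (inject≤ u le) ≡ Data.Sum.map id (λ y → inject≤ y le′) (splitAt m u)
splitAt-inject≤ m {n} {n'} le le′ u with splitAt m u in eq
... | inj₁ x = trans (cong (splitAt m) u≡) (splitAt-↑ˡ m x n')
  where
  u≡ : inject≤ u le ≡ x ↑ˡ n'
  u≡ = toℕ-injective (begin
    toℕ (inject≤ u le)  ≡⟨ toℕ-inject≤ u le ⟩
    toℕ u               ≡⟨ cong toℕ (splitAt⁻¹-↑ˡ eq) ⟨
    toℕ (x ↑ˡ n)        ≡⟨ toℕ-↑ˡ x n ⟩
    toℕ x               ≡⟨ toℕ-↑ˡ x n' ⟨
    toℕ (x ↑ˡ n')       ∎)
    where open ≡-Reasoning
... | inj₂ y = trans (cong (splitAt m) u≡) (splitAt-↑ʳ m n' (inject≤ y le′))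
  where
  u≡ : inject≤ u le ≡ m ↑ʳ inject≤ y le′
  u≡ = toℕ-injective (begin
    toℕ (inject≤ u le)        ≡⟨ toℕ-inject≤ u le ⟩
    toℕ u                     ≡⟨ cong toℕ (splitAt⁻¹-↑ʳ eq) ⟨
    toℕ (m ↑ʳ y)              ≡⟨ toℕ-↑ʳ m y ⟩
    m + toℕ y                 ≡⟨ cong (_+_ m) (toℕ-inject≤ y le′) ⟨
    m + toℕ (inject≤ y le′)   ≡⟨ toℕ-↑ʳ m (inject≤ y le′) ⟨
    toℕ (m ↑ʳ inject≤ y le′)  ∎)
    where open ≡-Reasoning

[2j]/2≡j : ∀ j → (j * 2) / 2 ≡ j
[2j]/2≡j j = m*n/n≡m j 2

[2j+1]/2≡j : ∀ j → suc (j * 2) / 2 ≡ j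
[2j+1]/2≡j j = trans (+-distrib-/ 1 (j * 2) (subst (λ r → 1 + r < 2) (sym (m*n%n≡0 j 2)) ≤-refl)) ([2j]/2≡j j)

2j+1<2t : ∀ {j t} → j < t → suc (j * 2) < 2 * t
2j+1<2t {j} {t} j<t = subst (suc (j * 2) <_) (*-comm t 2) (*-monoˡ-≤ 2 j<t)

edgeIndex : ∀ {m} → ℕ → Fin m → ℕ
edgeIndex offset v = (toℕ v ∸ offset) / 2

module MatchingEdge (L : Graph) {t j : ℕ} (j<t : j < t) where

  lowerEnd upperEnd : Fin (V L + 2 * t)
  lowerEnd = V L ↑ʳ fromℕ< (<-trans (n<1+n (j * 2)) (2j+1<2t j<t))
  upperEnd = V L ↑ʳ fromℕ< (2j+1<2t j<t)

  toℕ-lowerEnd : toℕ lowerEnd ≡ V L + j * 2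
  toℕ-lowerEnd = trans (toℕ-↑ʳ (V L) _) (cong (_+_ (V L)) (toℕ-fromℕ< _))

  toℕ-upperEnd : toℕ upperEnd ≡ V L + suc (j * 2)
  toℕ-upperEnd = trans (toℕ-↑ʳ (V L) _) (cong (_+_ (V L)) (toℕ-fromℕ< _))

  lowerEnd<upperEnd : toℕ lowerEnd < toℕ upperEnd
  lowerEnd<upperEnd rewrite toℕ-lowerEnd | toℕ-upperEnd = +-monoʳ-< (V L) (n<1+n (j * 2))

  adjacent : T (Adj (L ∪G matching t) lowerEnd upperEnd)
  adjacent rewrite adj-∪G L (matching t) lowerEnd upperEnd
    | splitAt-↑ʳ (V L) (2 * t) (fromℕ< (<-trans (n<1+n (j * 2)) (2j+1<2t j<t)))
    | splitAt-↑ʳ (V L) (2 * t) (fromℕ< (2j+1<2t j<t))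
    | toℕ-fromℕ< (<-trans (n<1+n (j * 2)) (2j+1<2t j<t)) | toℕ-fromℕ< (2j+1<2t j<t)
    | [2j]/2≡j j | [2j+1]/2≡j j = Equivalence.from T-∨ (inj₁ (≡⇒≡ᵇ j j refl))

  edgeIndex-lowerEnd : edgeIndex (V L) lowerEnd ≡ j
  edgeIndex-lowerEnd rewrite toℕ-lowerEnd | m+n∸m≡n (V L) (j * 2) = [2j]/2≡j j

  edgeIndex-upperEnd : edgeIndex (V L) upperEnd ≡ j
  edgeIndex-upperEnd rewrite toℕ-upperEnd | m+n∸m≡n (V L) (suc (j * 2)) = [2j+1]/2≡j j

length-filterᵇ+length-filterᵇ-not : (p : A → Bool) (xs : List A) →
  length (filterᵇ p xs) + length (filterᵇ (not ∘ p) xs) ≡ length xs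
length-filterᵇ+length-filterᵇ-not p [] = refl
length-filterᵇ+length-filterᵇ-not p (x ∷ xs) with p x
... | true = cong suc (length-filterᵇ+length-filterᵇ-not p xs)
... | false = trans (+-suc _ _) (cong suc (length-filterᵇ+length-filterᵇ-not p xs))

Unique-++⁺-separated : (h : A → ℕ) (b : ℕ) {xs ys : List A} → Unique xs → Unique ys →
  (∀ {x} → x ∈ xs → h x < b) → (∀ {y} → y ∈ ys → b ≤ h y) → Unique (xs ++ ys)
Unique-++⁺-separated h b u-xs u-ys below above =
  Unique.++⁺ u-xs u-ys (λ (x∈xs , x∈ys) → <⇒≱ (below x∈xs) (above x∈ys))

if-elim : (P : A → Set) (b : Bool) {x y : A} → P x → P y → P (if b then x else y)
if-elim P true px _ = px
if-elim P false _ py = py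

-- Restricting a vertex set of L ∪ tP₂ to L ∪ t₂P₂ loses, for every one of the extra t − t₂
-- matching edges, either an uncovered edge or a vertex of the set.
module Restriction (L : Graph) {t₂ t : ℕ} (t₂≤t : t₂ ≤ t) where

  H₂ H : Graph
  H₂ = L ∪G matching t₂
  H = L ∪G matching t

  2t₂≤2t : 2 * t₂ ≤ 2 * t
  2t₂≤2t = *-monoʳ-≤ 2 t₂≤t

  ι : Fin (V H₂) → Fin (V H)
  ι u = inject≤ u (+-monoʳ-≤ (V L) 2t₂≤2t)

  toℕ-ι : ∀ u → toℕ (ι u) ≡ toℕ u
  toℕ-ι u = toℕ-inject≤ u _

  ι-injective : Injective _≡_ _≡_ ι
  ι-injective {u} {v} eq = toℕ-injective (trans (sym (toℕ-ι u)) (trans (cong toℕ eq) (toℕ-ι v)))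

  ι<V₂ : ∀ u → toℕ (ι u) < V H₂
  ι<V₂ u = subst (_< V H₂) (sym (toℕ-ι u)) (toℕ<n u)

  Adj-ι : ∀ u v → Adj H (ι u) (ι v) ≡ Adj H₂ u v
  Adj-ι u v = cong₂ _∨_ (adj-ι u v) (adj-ι v u)
    where
    adj-ι : ∀ u v → adj H (ι u) (ι v) ≡ adj H₂ u v
    adj-ι u v rewrite adj-∪G L (matching t) (ι u) (ι v) | adj-∪G L (matching t₂) u v
      | splitAt-inject≤ (V L) (+-monoʳ-≤ (V L) 2t₂≤2t) 2t₂≤2t u
      | splitAt-inject≤ (V L) (+-monoʳ-≤ (V L) 2t₂≤2t) 2t₂≤2t v
      with splitAt (V L) u | splitAt (V L) v
    ... | inj₁ _ | inj₁ _ = refl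
    ... | inj₁ _ | inj₂ _ = refl
    ... | inj₂ _ | inj₁ _ = refl
    ... | inj₂ x | inj₂ y rewrite toℕ-inject≤ x 2t₂≤2t | toℕ-inject≤ y 2t₂≤2t = refl

  extra : ℕ
  extra = t ∸ t₂

  newIndex : Fin extra → ℕ
  newIndex i = t₂ + toℕ i

  newIndex<t : ∀ i → newIndex i < t
  newIndex<t i = subst (newIndex i <_) (m+[n∸m]≡n t₂≤t) (+-monoʳ-< t₂ (toℕ<n i))

  newIndex-injective : ∀ {i i'} → newIndex i ≡ newIndex i' → i ≡ i'
  newIndex-injective eq = toℕ-injective (+-cancelˡ-≡ t₂ _ _ eq)

  lower upper : Fin extra → Fin (V H)
  lower i = MatchingEdge.lowerEnd L (newIndex<t i)
  upper i = MatchingEdge.upperEnd L (newIndex<t i)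

  V₂≤lower : ∀ i → V H₂ ≤ toℕ (lower i)
  V₂≤lower i rewrite MatchingEdge.toℕ-lowerEnd L (newIndex<t i) =
    +-monoʳ-≤ (V L) (subst (_≤ newIndex i * 2) (*-comm t₂ 2) (*-monoˡ-≤ 2 (m≤m+n t₂ (toℕ i))))

  V₂≤upper : ∀ i → V H₂ ≤ toℕ (upper i)
  V₂≤upper i = <⇒≤ (<-≤-trans (s≤s (V₂≤lower i)) (MatchingEdge.lowerEnd<upperEnd L (newIndex<t i)))

  ιpair : Fin (V H₂) × Fin (V H₂) → Fin (V H) × Fin (V H)
  ιpair (u , v) = ι u , ι v

  ιpair-injective : Injective _≡_ _≡_ ιpair
  ιpair-injective eq = cong₂ _,_ (ι-injective (cong proj₁ eq)) (ι-injective (cong proj₂ eq))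

  newEdge : Fin extra → Fin (V H) × Fin (V H)
  newEdge i = lower i , upper i

  newEdge-injective : Injective _≡_ _≡_ newEdge
  newEdge-injective {i} {i'} eq = newIndex-injective (begin
    newIndex i                          ≡⟨ MatchingEdge.edgeIndex-lowerEnd L (newIndex<t i) ⟨
    edgeIndex (V L) (proj₁ (newEdge i))  ≡⟨ cong (edgeIndex (V L) ∘ proj₁) eq ⟩
    edgeIndex (V L) (proj₁ (newEdge i')) ≡⟨ MatchingEdge.edgeIndex-lowerEnd L (newIndex<t i') ⟩
    newIndex i'                         ∎)
    where open ≡-Reasoning

  module _ (R : VSet (V H)) where

    restriction : VSet (V H₂)
    restriction = tabulateᵥ (lookup R ∘ ι)

    lookup-restriction : ∀ u → lookup restriction u ≡ lookup R (ι u)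
    lookup-restriction = lookup∘tabulate (lookup R ∘ ι)

    avoids : Fin extra → Bool
    avoids i = not (lookup R (lower i)) ∧ not (lookup R (upper i))

    avoided hit : List (Fin extra)
    avoided = filterᵇ avoids (allFin extra)
    hit = filterᵇ (not ∘ avoids) (allFin extra)

    length-avoided+hit : length avoided + length hit ≡ extra
    length-avoided+hit = trans (length-filterᵇ+length-filterᵇ-not avoids (allFin extra)) (length-tabulate id)

    OutsideEdge-ι : ∀ {u v} → OutsideEdge H₂ restriction u v → OutsideEdge H R (ι u) (ι v)
    OutsideEdge-ι {u} {v} e = record
      { ordered  = subst₂ _<_ (sym (toℕ-ι u)) (sym (toℕ-ι v)) ordered
      ; adjacent = subst T (sym (Adj-ι u v)) adjacent
      ; left∉    = trans (sym (lookup-restriction u)) left∉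
      ; right∉   = trans (sym (lookup-restriction v)) right∉
      }
      where open OutsideEdge e

    OutsideEdge-new : ∀ {i} → T (avoids i) → OutsideEdge H R (lower i) (upper i)
    OutsideEdge-new {i} avoided-i = record
      { ordered  = MatchingEdge.lowerEnd<upperEnd L (newIndex<t i)
      ; adjacent = MatchingEdge.adjacent L (newIndex<t i)
      ; left∉    = proj₁ (T-not∧not⁻ avoided-i)
      ; right∉   = proj₂ (T-not∧not⁻ avoided-i)
      }

    hitEnd : Fin extra → Fin (V H)
    hitEnd i = if lookup R (lower i) then lower i else upper i

    hitEnd-injective : Injective _≡_ _≡_ hitEnd
    hitEnd-injective {i} {i'} eq =
      newIndex-injective (trans (sym (edgeIndex-hitEnd i)) (trans (cong (edgeIndex (V L)) eq) (edgeIndex-hitEnd i')))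
      where
      edgeIndex-hitEnd : ∀ i → edgeIndex (V L) (hitEnd i) ≡ newIndex i
      edgeIndex-hitEnd i = if-elim (λ v → edgeIndex (V L) v ≡ newIndex i) (lookup R (lower i))
        (MatchingEdge.edgeIndex-lowerEnd L (newIndex<t i)) (MatchingEdge.edgeIndex-upperEnd L (newIndex<t i))

    hitEnd∈R : ∀ i → T (not (avoids i)) → T (lookup R (hitEnd i))
    hitEnd∈R i hit-i with lookup R (lower i) in lower∈
    ... | true = subst T (sym lower∈) tt
    ... | false with lookup R (upper i)
    ...   | true = tt
    ...   | false = ⊥-elim hit-i

    edgesOutside-restriction : edgesOutside H₂ restriction + length avoided ≤ edgesOutside H R
    edgesOutside-restriction = subst (_≤ edgesOutside H R) length-es (≤edgesOutside unique outside)
      where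
      es : List (Fin (V H) × Fin (V H))
      es = map ιpair (outsideEdges H₂ restriction) ++ map newEdge avoided
      length-es : length es ≡ edgesOutside H₂ restriction + length avoided
      length-es = trans (length-++ (map ιpair (outsideEdges H₂ restriction)))
                        (cong₂ _+_ (length-map ιpair (outsideEdges H₂ restriction)) (length-map newEdge avoided))
      unique : Unique es
      unique = Unique-++⁺-separated (toℕ ∘ proj₁) (V H₂)
        (Unique.map⁺ ιpair-injective (Unique-outsideEdges {H₂} {restriction}))
        (Unique.map⁺ newEdge-injective (Unique-filterᵇ⁺ avoids (Unique.allFin⁺ extra)))
        (λ e∈ → case-ι (∈-map⁻ ιpair e∈))
        (λ e∈ → case-new (∈-map⁻ newEdge e∈))
        where
        case-ι : ∀ {e} → Σ[ e₂ ∈ _ ] e₂ ∈ outsideEdges H₂ restriction × e ≡ ιpair e₂ → toℕ (proj₁ e) < V H₂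
        case-ι ((u , _) , _ , refl) = ι<V₂ u
        case-new : ∀ {e} → Σ[ i ∈ Fin extra ] i ∈ avoided × e ≡ newEdge i → V H₂ ≤ toℕ (proj₁ e)
        case-new (i , _ , refl) = V₂≤lower i
      outside : ∀ {u v} → (u , v) ∈ es → OutsideEdge H R u v
      outside uv∈ with ∈-++⁻ (map ιpair (outsideEdges H₂ restriction)) uv∈
      ... | inj₁ uv∈ι with ∈-map⁻ ιpair uv∈ι
      ...   | _ , uv∈₂ , refl = OutsideEdge-ι (∈-outsideEdges⁻ {H₂} {restriction} uv∈₂)
      outside uv∈ | inj₂ uv∈new with ∈-map⁻ newEdge uv∈new
      ...   | _ , i∈ , refl = OutsideEdge-new (proj₂ (∈-filterᵇ⁻ {p = avoids} {xs = allFin extra} i∈))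

    size-restriction : size restriction + length hit ≤ size R
    size-restriction = subst (_≤ size R) length-vs (≤size R unique inside)
      where
      vs : List (Fin (V H))
      vs = map ι (members restriction) ++ map hitEnd hit
      length-vs : length vs ≡ size restriction + length hit
      length-vs = trans (length-++ (map ι (members restriction)))
        (cong₂ _+_ (trans (length-map ι (members restriction)) (sym (size≡length-members restriction))) (length-map hitEnd hit))
      unique : Unique vs
      unique = Unique-++⁺-separated toℕ (V H₂)
        (Unique.map⁺ ι-injective (Unique-filterᵇ⁺ (lookup restriction) (Unique.allFin⁺ _)))
        (Unique.map⁺ hitEnd-injective (Unique-filterᵇ⁺ (not ∘ avoids) (Unique.allFin⁺ extra)))
        (λ v∈ → case-ι (∈-map⁻ ι v∈))
        (λ v∈ → case-hit (∈-map⁻ hitEnd v∈))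
        where
        case-ι : ∀ {v} → Σ[ u ∈ _ ] u ∈ members restriction × v ≡ ι u → toℕ v < V H₂
        case-ι (u , _ , refl) = ι<V₂ u
        case-hit : ∀ {v} → Σ[ i ∈ Fin extra ] i ∈ hit × v ≡ hitEnd i → V H₂ ≤ toℕ v
        case-hit (i , _ , refl) = if-elim (λ v → V H₂ ≤ toℕ v) (lookup R (lower i)) (V₂≤lower i) (V₂≤upper i)
      inside : ∀ {v} → v ∈ vs → T (lookup R v)
      inside v∈ with ∈-++⁻ (map ι (members restriction)) v∈
      ... | inj₁ v∈ι with ∈-map⁻ ι v∈ι
      ...   | u , u∈ , refl = subst T (lookup-restriction u) (proj₂ (∈-filterᵇ⁻ {p = lookup restriction} {xs = allFin _} u∈))
      inside v∈ | inj₂ v∈hit with ∈-map⁻ hitEnd v∈hit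
      ...   | i , i∈ , refl = hitEnd∈R i (proj₂ (∈-filterᵇ⁻ {p = not ∘ avoids} {xs = allFin extra} i∈))

  Uncoverable-∪matching : ∀ {s c} → (∀ i → i ≤ s → Uncoverable (s ∸ i) H₂ (c + i)) → Uncoverable s H (c + extra)
  Uncoverable-∪matching {s} {c} uncoverable₂ R small few =
    uncoverable₂ i i≤s (restriction R) small₂ (m+n≤o⇒m≤o∸n _ few′)
    where
    i = length (avoided R)
    m = length (hit R)
    few′ : edgesOutside H₂ (restriction R) + i ≤ s
    few′ = ≤-trans (edgesOutside-restriction R) few
    i≤s : i ≤ s
    i≤s = ≤-trans (m≤n+m i _) few′
    small₂ : size (restriction R) ≤ c + i
    small₂ = +-cancelʳ-≤ m _ _ (begin
      size (restriction R) + m    ≤⟨ size-restriction R ⟩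
      size R                      ≤⟨ small ⟩
      c + extra                   ≡⟨ cong (_+_ c) (length-avoided+hit R) ⟨
      c + (i + m)                 ≡⟨ +-assoc c i m ⟨
      c + i + m                   ∎)
      where open ≤-Reasoning

-t≤r⇒t+r≡+ : ∀ t (r : ℤ) → - (+ t) ≤ℤ r → Σ[ c ∈ ℕ ] (+ t) +ℤ r ≡ + c
-t≤r⇒t+r≡+ t r -t≤r = _ , sym (ℤ.0≤i⇒+∣i∣≡i 0≤t+r)
  where
  0≤t+r : + 0 ≤ℤ (+ t) +ℤ r
  0≤t+r = subst (_≤ℤ (+ t) +ℤ r) (ℤ.+-inverseʳ (+ t)) (ℤ.+-monoʳ-≤ (+ t) -t≤r)

+-shift : ∀ t d (r : ℤ) {c} → (+ t) +ℤ r ≡ + c → (+ (t + d)) +ℤ r ≡ + (c + d)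
+-shift t d r {c} t+r≡c = begin
  (+ (t + d)) +ℤ r        ≡⟨ cong (_+ℤ r) (ℤ.pos-+ t d) ⟩
  (+ t +ℤ + d) +ℤ r       ≡⟨ ℤ.+-assoc (+ t) (+ d) r ⟩
  + t +ℤ (+ d +ℤ r)       ≡⟨ cong (_+ℤ_ (+ t)) (ℤ.+-comm (+ d) r) ⟩
  + t +ℤ (r +ℤ + d)       ≡⟨ ℤ.+-assoc (+ t) r (+ d) ⟨
  (+ t +ℤ r) +ℤ + d       ≡⟨ cong (_+ℤ + d) t+r≡c ⟩
  + c +ℤ + d              ≡⟨ ℤ.pos-+ c d ⟨
  + (c + d)               ∎
  where open ≡-Reasoning

DoubledBound : (n s a : ℕ) → ℤ → Set
DoubledBound n s a k = (+ 2) *ℤ k *ℤ (+ n) +ℤ (+ 2) *ℤ (+ s) <ℤ (+ 2) *ℤ (+ a) +ℤ k *ℤ (k +ℤ + 1)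

DoubledBound-+ : ∀ n s a k → 2 * k * n + 2 * s < 2 * a + k * (k + 1) → DoubledBound n s a (+ k)
DoubledBound-+ n s a k bound = subst₂ _<ℤ_ (sym lhs) (sym rhs) (+<+ bound)
  where
  lhs : (+ 2) *ℤ (+ k) *ℤ (+ n) +ℤ (+ 2) *ℤ (+ s) ≡ + (2 * k * n + 2 * s)
  lhs = trans (cong₂ _+ℤ_ (trans (cong (_*ℤ + n) (sym (ℤ.pos-* 2 k))) (sym (ℤ.pos-* (2 * k) n))) (sym (ℤ.pos-* 2 s)))
              (sym (ℤ.pos-+ (2 * k * n) (2 * s)))
  rhs : (+ 2) *ℤ (+ a) +ℤ (+ k) *ℤ ((+ k) +ℤ + 1) ≡ + (2 * a + k * (k + 1))
  rhs = trans (cong₂ _+ℤ_ (sym (ℤ.pos-* 2 a)) (trans (cong (_*ℤ_ (+ k)) (sym (ℤ.pos-+ k 1))) (sym (ℤ.pos-* k (k + 1)))))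
              (sym (ℤ.pos-+ (2 * a) (k * (k + 1))))

lemma3p4 : (s : ℕ) → 1 ≤ s →
    ((G : Graph) (r1 : ℕ) → r1 < q s G →
      (n : ℕ) → V G ≤ n → (a : ℕ) → IsAR n G a →
      2 * r1 * n + 2 * s < 2 * a + r1 * (r1 + 1))
    ×
    ((L : Graph) (t₂ : ℕ) (r₂ : ℤ) → - (+ t₂) ≤ℤ r₂ →
      ((i : ℕ) → i ≤ s → (+ (t₂ + i)) +ℤ r₂ <ℤ + q (s ∸ i) (L ∪G matching t₂)) →
      (t : ℕ) → t₂ ≤ t → (n : ℕ) → 2 * t + V L ≤ n →
      (a : ℕ) → IsAR n (L ∪G matching t) a →
      (+ 2) *ℤ ((+ t) +ℤ r₂) *ℤ (+ n) +ℤ (+ 2) *ℤ (+ s)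
        <ℤ (+ 2) *ℤ (+ a) +ℤ ((+ t) +ℤ r₂) *ℤ (((+ t) +ℤ r₂) +ℤ + 1))
lemma3p4 s 1≤s =
  (λ G r₁ r₁<q n V≤n a isAR → AR-bound G 1≤s V≤n (<q⇒Uncoverable s G r₁<q) (proj₁ isAR)) ,
  λ L t₂ r₂ -t₂≤r₂ q-large t t₂≤t n 2t+V≤n a isAR →
    let (c , t₂+r₂≡c) = -t≤r⇒t+r≡+ t₂ r₂ -t₂≤r₂
        open Restriction L t₂≤t
        uncoverable : Uncoverable s H (c + extra)
        uncoverable = Uncoverable-∪matching λ i i≤s →
          <q⇒Uncoverable (s ∸ i) H₂
            (ℤ.drop‿+<+ (subst (_<ℤ + q (s ∸ i) H₂) (+-shift t₂ i r₂ t₂+r₂≡c) (q-large i i≤s)))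
        t+r₂≡ : (+ t) +ℤ r₂ ≡ + (c + extra)
        t+r₂≡ = subst (λ t′ → (+ t′) +ℤ r₂ ≡ + (c + extra)) (m+[n∸m]≡n t₂≤t)
                      (+-shift t₂ extra r₂ t₂+r₂≡c)
    in subst (DoubledBound n s a) (sym t+r₂≡)
         (DoubledBound-+ n s a (c + extra)
           (AR-bound H 1≤s (subst (_≤ n) (+-comm (2 * t) (V L)) 2t+V≤n) uncoverable (proj₁ isAR)))
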